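{- Let $G$ be a directed graph, and let $G'$ be the directed graph with $V(G')=V(G)\sqcup\{w\}$ and $E(G')=E(G)\sqcup\{\alpha\}$, where $w$ is a new vertex and $\alpha$ is either a one-directional arrow from $w$ to some vertex $v\in V(G)$, or a bi-directional arrow between $w$ and some vertex $v\in V(G)$. Then $\operatorname{Pic}(G)\cong \operatorname{Pic}(G')$.
   Context: A directed graph $G$ has a finite nonempty vertex set $V(G)=\{v_1,\dots,v_n\}$ and a finite collection $E(G)$ of arrows (multiple arrows allowed, no loops). Each arrow joins two distinct vertices and is either one-directional (from $v_i$ to $v_j$) or bi-directional (between $v_i$ and $v_j$); a bi-directional arrow counts both as an arrow from $v_i$ to $v_j$ and as an arrow from $v_j$ to $v_i$. The Laplacian $L_G$ is the $n\times n$ integer matrix whose $(i,i)$ entry is the number of outgoing arrows of $v_i$ (its out-degree) and whose $(i,j)$ entry, $i\neq j$, is minus the number of arrows from $v_i$ to $v_j$. The Picard group is $\operatorname{Pic}(G)=\operatorname{coker}(L_G^T\colon \mathbb{Z}^n\to\mathbb{Z}^n)=\mathbb{Z}^n/L_G^T\mathbb{Z}^n$, and the Jacobian $\operatorname{Jac}(G)$ is the torsion subgroup of $\operatorname{Pic}(G)$. -}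

module Defs where

open import Data.Nat using (ℕ; zero; suc)
open import Data.Integer using (ℤ; +_; _+_; _-_; _*_; -_)
open import Data.Bool using (Bool; true; false; _∧_; _∨_)
open import Data.Fin using (Fin; zero; suc)
open import Data.Fin.Properties using (suc-injective)
open import Data.List using (List; []; _∷_; _++_; map)
open import Data.Product using (∃)
open import Relation.Binary.PropositionalEquality using (_≡_; _≢_)
open import Relation.Nullary.Decidable using (⌊_⌋)
open import Relation.Nullary using (yes; no)
open import Algebra.Bundles.Raw using (RawGroup)
import Data.Fin as F

-- If bidir = false it is a one-directional arrow from src to tgt;
-- if bidir = true it is a bi-directional arrow between src and tgt.
record Arrow (n : ℕ) : Set where
  constructor arrow
  field
    src    : Fin n
    tgt    : Fin n
    bidir  : Bool
    noLoop : src ≢ tgt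

open Arrow public

record DiGraph (n : ℕ) : Set where
  constructor digraph
  field
    arrows : List (Arrow n)

open DiGraph public

infix 4 _=ᶠ_
_=ᶠ_ : ∀ {n} → Fin n → Fin n → Bool
i =ᶠ j = ⌊ i F.≟ j ⌋

isArrowFromTo : ∀ {n} → Arrow n → Fin n → Fin n → Bool
isArrowFromTo a i j = ((src a =ᶠ i) ∧ (tgt a =ᶠ j)) ∨ (bidir a ∧ ((src a =ᶠ j) ∧ (tgt a =ᶠ i)))

isOutgoing : ∀ {n} → Arrow n → Fin n → Bool
isOutgoing a i = (src a =ᶠ i) ∨ (bidir a ∧ (tgt a =ᶠ i))

count : ∀ {A : Set} → (A → Bool) → List A → ℕ
count p [] = 0
count p (x ∷ xs) with p x
... | true  = suc (count p xs)
... | false = count p xs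

numArrows : ∀ {n} → DiGraph n → Fin n → Fin n → ℕ
numArrows G i j = count (λ a → isArrowFromTo a i j) (arrows G)

outDeg : ∀ {n} → DiGraph n → Fin n → ℕ
outDeg G i = count (λ a → isOutgoing a i) (arrows G)

laplacian : ∀ {n} → DiGraph n → Fin n → Fin n → ℤ
laplacian G i j with i F.≟ j
... | yes _ = + outDeg G i
... | no  _ = - (+ numArrows G i j)

sumFin : ∀ {n} → (Fin n → ℤ) → ℤ
sumFin {zero}  f = + 0
sumFin {suc n} f = f zero + sumFin (λ i → f (suc i))

laplacianT· : ∀ {n} → DiGraph n → (Fin n → ℤ) → Fin n → ℤ
laplacianT· G z i = sumFin (λ j → laplacian G j i * z j)

-- Equality in Pic(G) = ℤ^n / L_G^T ℤ^n : x ≈ y iff x - y ∈ image of L_G^T.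
_≈Pic[_]_ : ∀ {n} → (Fin n → ℤ) → DiGraph n → (Fin n → ℤ) → Set
x ≈Pic[ G ] y = ∃ λ z → ∀ i → x i - y i ≡ laplacianT· G z i

Pic : ∀ {n} → DiGraph n → RawGroup _ _
Pic {n} G = record
  { Carrier = Fin n → ℤ
  ; _≈_     = λ x y → x ≈Pic[ G ] y
  ; _∙_     = λ x y i → x i + y i
  ; ε       = λ _ → + 0
  ; _⁻¹     = λ x i → - x i
  }

-- Lifting an arrow of G to G' (old vertex v becomes suc v; the new vertex w is zero).
liftArrow : ∀ {n} → Arrow n → Arrow (suc n)
liftArrow (arrow s t b nl) = arrow (suc s) (suc t) b (λ eq → nl (suc-injective eq))

wNew : ∀ {n} → Fin (suc n)
wNew = zero

newArrow : ∀ {n} → Fin n → Bool → Arrow (suc n)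
newArrow v b = arrow zero (suc v) b (λ ())

extend : ∀ {n} → DiGraph n → Fin n → Bool → DiGraph (suc n)
extend G v b = digraph (newArrow v b ∷ map liftArrow (arrows G))

-- Number the new vertex w as zero and write b ∈ {0, 1} for "α is bi-directional".
-- Only the row and column of w and the diagonal entry at v change, so for z ∈ ℤⁿ⁺¹
--   (L_{G'}ᵀ z)_w = z_w − b z_v   and   (L_{G'}ᵀ z)_i = (L_Gᵀ z|_G)_i + [i = v] (b z_v − z_w).
-- Hence on the potentials with z_w = b z_v, L_{G'}ᵀ acts as L_Gᵀ padded with a 0 at w, which
-- makes x ↦ (0, x) a well-defined injective map Pic G → Pic G'.  It is onto because firing w
-- y_w times moves that value onto v: y is equivalent to (0, y|_G + y_w e_v).
module Submission where

open import Defs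
open import Data.Nat using (ℕ)
import Data.Nat as ℕ using (zero; suc)
open import Data.Fin using (Fin)
open import Data.Bool using (Bool)
open import Data.Product using (∃)
open import Algebra.Morphism.Structures using (module GroupMorphisms)

open import Data.Bool using (true; false; _∧_; _∨_)
open import Data.Bool.Properties using (∧-zeroʳ; ∨-identityʳ)
open import Data.Fin using (zero; suc)
import Data.Fin as F
open import Data.Fin.Properties using (suc-injective)
open import Data.Integer using (ℤ; +_; _+_; _-_; _*_; -_)
import Data.Integer.Properties as ℤ
open import Data.Integer.Tactic.RingSolver using (solve-∀)
open import Data.List using (List; []; _∷_; map)
open import Data.Product using (_,_)
import Data.Vec.Functional as Vector
open import Function using (_∘_)
open import Relation.Binary.PropositionalEquality
open import Relation.Nullary using (Dec; yes; no; contradiction)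
open import Relation.Nullary.Decidable using (⌊⌋-map′)
open import Algebra.Properties.CommutativeSemigroup ℤ.+-commutativeSemigroup using (interchange)
open ≡-Reasoning

⟦_⟧ : Bool → ℤ
⟦ true  ⟧ = + 1
⟦ false ⟧ = + 0

⟦⟧-∧ : ∀ b c → ⟦ b ∧ c ⟧ ≡ ⟦ b ⟧ * ⟦ c ⟧
⟦⟧-∧ true  c = sym (ℤ.*-identityˡ ⟦ c ⟧)
⟦⟧-∧ false c = sym (ℤ.*-zeroˡ ⟦ c ⟧)

=ᶠ-refl : ∀ {n} (i : Fin n) → (i =ᶠ i) ≡ true
=ᶠ-refl i with i F.≟ i
... | yes _  = refl
... | no i≢i = contradiction refl i≢i

=ᶠ-≢ : ∀ {n} {i j : Fin n} → i ≢ j → (i =ᶠ j) ≡ false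
=ᶠ-≢ {i = i} {j} i≢j with i F.≟ j
... | yes i≡j = contradiction i≡j i≢j
... | no _    = refl

=ᶠ-sym : ∀ {n} (i j : Fin n) → (i =ᶠ j) ≡ (j =ᶠ i)
=ᶠ-sym i j with i F.≟ j
... | yes refl = sym (=ᶠ-refl i)
... | no i≢j   = sym (=ᶠ-≢ (i≢j ∘ sym))

suc-=ᶠ : ∀ {n} (i j : Fin n) → (suc i =ᶠ suc j) ≡ (i =ᶠ j)
suc-=ᶠ i j = ⌊⌋-map′ (cong suc) suc-injective (i F.≟ j)

⟦=ᶠ⟧-subst : ∀ {n} (f : Fin n → ℤ) (v i : Fin n) →
             ⟦ v =ᶠ i ⟧ * f i ≡ ⟦ v =ᶠ i ⟧ * f v
⟦=ᶠ⟧-subst f v i with v F.≟ i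
... | yes refl = refl
... | no _     = trans (ℤ.*-zeroˡ (f i)) (sym (ℤ.*-zeroˡ (f v)))

count-∷ : ∀ {A : Set} (p : A → Bool) x xs → + count p (x ∷ xs) ≡ ⟦ p x ⟧ + + count p xs
count-∷ p x xs with p x
... | true  = refl
... | false = refl

count-map : ∀ {A B : Set} {p : B → Bool} {q : A → Bool} (f : A → B) →
            p ∘ f ≗ q → ∀ xs → count p (map f xs) ≡ count q xs
count-map f p∘f≗q [] = refl
count-map {p = p} {q} f p∘f≗q (x ∷ xs) with p (f x) | q x | p∘f≗q x
... | true  | true  | _ = cong ℕ.suc (count-map f p∘f≗q xs)
... | false | false | _ = count-map f p∘f≗q xs

count-const-false : ∀ {A : Set} (xs : List A) → count (λ _ → false) xs ≡ 0
count-const-false []       = refl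
count-const-false (_ ∷ xs) = count-const-false xs

sumFin-cong : ∀ {n} {f g : Fin n → ℤ} → f ≗ g → sumFin f ≡ sumFin g
sumFin-cong {ℕ.zero}  f≗g = refl
sumFin-cong {ℕ.suc n} f≗g = cong₂ _+_ (f≗g zero) (sumFin-cong (f≗g ∘ suc))

sumFin-+ : ∀ {n} (f g : Fin n → ℤ) → sumFin (λ i → f i + g i) ≡ sumFin f + sumFin g
sumFin-+ {ℕ.zero}  f g = refl
sumFin-+ {ℕ.suc n} f g = trans (cong (_+_ (f zero + g zero)) (sumFin-+ (f ∘ suc) (g ∘ suc)))
  (interchange (f zero) (g zero) (sumFin (f ∘ suc)) (sumFin (g ∘ suc)))

sumFin-zero : ∀ {n} {f : Fin n → ℤ} → (∀ i → f i ≡ + 0) → sumFin f ≡ + 0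
sumFin-zero {ℕ.zero}  f≗0 = refl
sumFin-zero {ℕ.suc n} f≗0 = cong₂ _+_ (f≗0 zero) (sumFin-zero (f≗0 ∘ suc))

sumFin-δ : ∀ {n} (i : Fin n) (g : Fin n → ℤ) → sumFin (λ j → ⟦ j =ᶠ i ⟧ * g j) ≡ g i
sumFin-δ zero g = trans
  (cong₂ _+_ (ℤ.*-identityˡ (g zero)) (sumFin-zero (λ j → ℤ.*-zeroˡ (g (suc j)))))
  (ℤ.+-identityʳ (g zero))
sumFin-δ (suc i) g = trans (cong₂ _+_ (ℤ.*-zeroˡ (g zero)) sum-over-suc) (ℤ.+-identityˡ (g (suc i)))
  where
  sum-over-suc : sumFin (λ j → ⟦ suc j =ᶠ suc i ⟧ * g (suc j)) ≡ g (suc i)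
  sum-over-suc = trans
    (sumFin-cong (λ j → cong (λ c → ⟦ c ⟧ * g (suc j)) (suc-=ᶠ j i)))
    (sumFin-δ i (g ∘ suc))

laplacian-diag : ∀ {n} (G : DiGraph n) i → laplacian G i i ≡ + outDeg G i
laplacian-diag G i with i F.≟ i
... | yes _  = refl
... | no i≢i = contradiction refl i≢i

laplacian-offdiag : ∀ {n} (G : DiGraph n) i j → i ≢ j → laplacian G i j ≡ - + numArrows G i j
laplacian-offdiag G i j i≢j with i F.≟ j
... | yes i≡j = contradiction i≡j i≢j
... | no _    = refl

laplacianT-zero : ∀ {n} (G : DiGraph n) i → laplacianT· G (λ _ → + 0) i ≡ + 0
laplacianT-zero G i = sumFin-zero (λ j → ℤ.*-zeroʳ (laplacian G j i))

≈Pic-reflexive : ∀ {n} (G : DiGraph n) {x y : Fin n → ℤ} → x ≗ y → x ≈Pic[ G ] y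
≈Pic-reflexive G {x} {y} x≗y = (λ _ → + 0) , λ i → begin
  x i - y i                   ≡⟨ cong (_- y i) (x≗y i) ⟩
  y i - y i                   ≡⟨ ℤ.+-inverseʳ (y i) ⟩
  + 0                         ≡⟨ laplacianT-zero G i ⟨
  laplacianT· G (λ _ → + 0) i ∎

module _ {n : ℕ} where

  isOutgoing-liftArrow : (a : Arrow n) (i : Fin n) →
                         isOutgoing (liftArrow a) (suc i) ≡ isOutgoing a i
  isOutgoing-liftArrow (arrow s t d _) i =
    cong₂ (λ x y → x ∨ (d ∧ y)) (suc-=ᶠ s i) (suc-=ᶠ t i)

  isOutgoing-liftArrow-zero : (a : Arrow n) → isOutgoing (liftArrow a) zero ≡ false
  isOutgoing-liftArrow-zero (arrow _ _ d _) = ∧-zeroʳ d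

  isArrowFromTo-liftArrow : (a : Arrow n) (i j : Fin n) →
                            isArrowFromTo (liftArrow a) (suc i) (suc j) ≡ isArrowFromTo a i j
  isArrowFromTo-liftArrow (arrow s t d _) i j = cong₂ (λ x y → x ∨ (d ∧ y))
    (cong₂ _∧_ (suc-=ᶠ s i) (suc-=ᶠ t j))
    (cong₂ _∧_ (suc-=ᶠ s j) (suc-=ᶠ t i))

  isArrowFromTo-liftArrow-from-zero : (a : Arrow n) (j : Fin n) →
                                      isArrowFromTo (liftArrow a) zero (suc j) ≡ false
  isArrowFromTo-liftArrow-from-zero (arrow s _ d _) j =
    trans (cong (d ∧_) (∧-zeroʳ (suc s =ᶠ suc j))) (∧-zeroʳ d)

  isArrowFromTo-liftArrow-to-zero : (a : Arrow n) (i : Fin n) →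
                                    isArrowFromTo (liftArrow a) (suc i) zero ≡ false
  isArrowFromTo-liftArrow-to-zero (arrow s _ d _) i =
    cong₂ _∨_ (∧-zeroʳ (suc s =ᶠ suc i)) (∧-zeroʳ d)

embed : ∀ {n} → (Fin n → ℤ) → Fin (ℕ.suc n) → ℤ
embed x = + 0 Vector.∷ x

embed-+ : ∀ {n} (x y : Fin n → ℤ) → embed (λ i → x i + y i) ≗ λ k → embed x k + embed y k
embed-+ x y zero    = refl
embed-+ x y (suc i) = refl

embed-0 : ∀ {n} → embed {n} (λ _ → + 0) ≗ λ _ → + 0
embed-0 zero    = refl
embed-0 (suc i) = refl

embed-neg : ∀ {n} (x : Fin n → ℤ) → embed (λ i → - x i) ≗ λ k → - embed x k
embed-neg x zero    = refl
embed-neg x (suc i) = refl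

module _ {n : ℕ} (G : DiGraph n) (v : Fin n) (b : Bool) where
  private
    H = extend G v b

  count-extend : ∀ (p : Arrow (ℕ.suc n) → Bool) {q : Arrow n → Bool} → p ∘ liftArrow ≗ q →
                 + count p (arrows H) ≡ ⟦ p (newArrow v b) ⟧ + + count q (arrows G)
  count-extend p p∘lift≗q = trans (count-∷ p _ _)
    (cong (λ k → ⟦ p (newArrow v b) ⟧ + + k) (count-map liftArrow p∘lift≗q (arrows G)))

  count-extend-newArrow : ∀ (p : Arrow (ℕ.suc n) → Bool) → (∀ a → p (liftArrow a) ≡ false) →
                          + count p (arrows H) ≡ ⟦ p (newArrow v b) ⟧
  count-extend-newArrow p p∘lift≗false = begin
    + count p (arrows H)
      ≡⟨ count-extend p p∘lift≗false ⟩
    ⟦ p (newArrow v b) ⟧ + + count (λ _ → false) (arrows G)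
      ≡⟨ cong (λ k → ⟦ p (newArrow v b) ⟧ + + k) (count-const-false (arrows G)) ⟩
    ⟦ p (newArrow v b) ⟧ + + 0
      ≡⟨ ℤ.+-identityʳ _ ⟩
    ⟦ p (newArrow v b) ⟧ ∎

  outDeg-extend-suc : ∀ j → + outDeg H (suc j) ≡ ⟦ b ∧ (v =ᶠ j) ⟧ + + outDeg G j
  outDeg-extend-suc j = trans
    (count-extend (λ a → isOutgoing a (suc j)) (λ a → isOutgoing-liftArrow a j))
    (cong (λ c → ⟦ b ∧ c ⟧ + + outDeg G j) (suc-=ᶠ v j))

  numArrows-extend-suc-suc : ∀ j i → + numArrows H (suc j) (suc i) ≡ + numArrows G j i
  numArrows-extend-suc-suc j i = trans
    (count-extend (λ a → isArrowFromTo a (suc j) (suc i)) (λ a → isArrowFromTo-liftArrow a j i))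
    (cong (λ c → ⟦ c ⟧ + + numArrows G j i) (∧-zeroʳ b))

  laplacian-extend-zero-zero : laplacian H zero zero ≡ + 1
  laplacian-extend-zero-zero = trans (laplacian-diag H zero)
    (count-extend-newArrow (λ a → isOutgoing a zero) isOutgoing-liftArrow-zero)

  laplacian-extend-suc-zero : ∀ j → laplacian H (suc j) zero ≡ - (⟦ b ⟧ * ⟦ v =ᶠ j ⟧)
  laplacian-extend-suc-zero j = begin
    laplacian H (suc j) zero
      ≡⟨ laplacian-offdiag H (suc j) zero (λ ()) ⟩
    - + numArrows H (suc j) zero
      ≡⟨ cong -_ (count-extend-newArrow (λ a → isArrowFromTo a (suc j) zero)
                                        (λ a → isArrowFromTo-liftArrow-to-zero a j)) ⟩
    - ⟦ b ∧ (suc v =ᶠ suc j) ⟧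
      ≡⟨ cong (λ c → - ⟦ b ∧ c ⟧) (suc-=ᶠ v j) ⟩
    - ⟦ b ∧ (v =ᶠ j) ⟧
      ≡⟨ cong -_ (⟦⟧-∧ b (v =ᶠ j)) ⟩
    - (⟦ b ⟧ * ⟦ v =ᶠ j ⟧) ∎

  laplacian-extend-zero-suc : ∀ i → laplacian H zero (suc i) ≡ - ⟦ v =ᶠ i ⟧
  laplacian-extend-zero-suc i = begin
    laplacian H zero (suc i)
      ≡⟨ laplacian-offdiag H zero (suc i) (λ ()) ⟩
    - + numArrows H zero (suc i)
      ≡⟨ cong -_ (count-extend-newArrow (λ a → isArrowFromTo a zero (suc i))
                                        (λ a → isArrowFromTo-liftArrow-from-zero a i)) ⟩
    - ⟦ (suc v =ᶠ suc i) ∨ (b ∧ false) ⟧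
      ≡⟨ cong (λ c → - ⟦ c ⟧) (trans (cong (_ ∨_) (∧-zeroʳ b)) (∨-identityʳ _)) ⟩
    - ⟦ suc v =ᶠ suc i ⟧
      ≡⟨ cong (λ c → - ⟦ c ⟧) (suc-=ᶠ v i) ⟩
    - ⟦ v =ᶠ i ⟧ ∎

  laplacian-extend-suc-suc : ∀ j i → laplacian H (suc j) (suc i) ≡
                             laplacian G j i + ⟦ j =ᶠ i ⟧ * (⟦ b ⟧ * ⟦ v =ᶠ i ⟧)
  laplacian-extend-suc-suc j i = by-cases (j F.≟ i)
    where
    β = ⟦ b ⟧ * ⟦ v =ᶠ i ⟧
    by-cases : Dec (j ≡ i) → laplacian H (suc j) (suc i) ≡ laplacian G j i + ⟦ j =ᶠ i ⟧ * β
    by-cases (yes refl) = begin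
      laplacian H (suc j) (suc j)      ≡⟨ laplacian-diag H (suc j) ⟩
      + outDeg H (suc j)               ≡⟨ outDeg-extend-suc j ⟩
      ⟦ b ∧ (v =ᶠ j) ⟧ + + outDeg G j  ≡⟨ ℤ.+-comm ⟦ b ∧ (v =ᶠ j) ⟧ (+ outDeg G j) ⟩
      + outDeg G j + ⟦ b ∧ (v =ᶠ j) ⟧  ≡⟨ cong₂ _+_ (sym (laplacian-diag G j)) (⟦⟧-∧ b (v =ᶠ j)) ⟩
      laplacian G j j + β              ≡⟨ cong (_+_ (laplacian G j j)) (ℤ.*-identityˡ β) ⟨
      laplacian G j j + + 1 * β        ≡⟨ cong (λ c → laplacian G j j + ⟦ c ⟧ * β) (=ᶠ-refl j) ⟨
      laplacian G j j + ⟦ j =ᶠ j ⟧ * β ∎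
    by-cases (no j≢i) = begin
      laplacian H (suc j) (suc i)      ≡⟨ laplacian-offdiag H (suc j) (suc i) (j≢i ∘ suc-injective) ⟩
      - + numArrows H (suc j) (suc i)  ≡⟨ cong -_ (numArrows-extend-suc-suc j i) ⟩
      - + numArrows G j i              ≡⟨ laplacian-offdiag G j i j≢i ⟨
      laplacian G j i                  ≡⟨ ℤ.+-identityʳ _ ⟨
      laplacian G j i + + 0            ≡⟨ cong (_+_ (laplacian G j i)) (ℤ.*-zeroˡ β) ⟨
      laplacian G j i + + 0 * β        ≡⟨ cong (λ c → laplacian G j i + ⟦ c ⟧ * β) (=ᶠ-≢ j≢i) ⟨
      laplacian G j i + ⟦ j =ᶠ i ⟧ * β ∎

  laplacianT-extend-zero : ∀ z → laplacianT· H z zero ≡ z zero - ⟦ b ⟧ * z (suc v)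
  laplacianT-extend-zero z = begin
    laplacian H zero zero * z zero + sumFin (λ j → laplacian H (suc j) zero * z (suc j))
      ≡⟨ cong₂ _+_ (cong (_* z zero) laplacian-extend-zero-zero) (sumFin-cong column-entry) ⟩
    + 1 * z zero + sumFin (λ j → ⟦ j =ᶠ v ⟧ * - (⟦ b ⟧ * z (suc j)))
      ≡⟨ cong₂ _+_ (ℤ.*-identityˡ (z zero)) (sumFin-δ v (λ j → - (⟦ b ⟧ * z (suc j)))) ⟩
    z zero - ⟦ b ⟧ * z (suc v) ∎
    where
    -xy*w≡y*-xw : ∀ x y w → - (x * y) * w ≡ y * - (x * w)
    -xy*w≡y*-xw = solve-∀
    column-entry : ∀ j → laplacian H (suc j) zero * z (suc j) ≡ ⟦ j =ᶠ v ⟧ * - (⟦ b ⟧ * z (suc j))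
    column-entry j = begin
      laplacian H (suc j) zero * z (suc j) ≡⟨ cong (_* z (suc j)) (laplacian-extend-suc-zero j) ⟩
      - (⟦ b ⟧ * ⟦ v =ᶠ j ⟧) * z (suc j)   ≡⟨ cong (λ c → - (⟦ b ⟧ * ⟦ c ⟧) * z (suc j)) (=ᶠ-sym v j) ⟩
      - (⟦ b ⟧ * ⟦ j =ᶠ v ⟧) * z (suc j)   ≡⟨ -xy*w≡y*-xw ⟦ b ⟧ ⟦ j =ᶠ v ⟧ (z (suc j)) ⟩
      ⟦ j =ᶠ v ⟧ * - (⟦ b ⟧ * z (suc j))   ∎

  laplacianT-extend-suc : ∀ z i → laplacianT· H z (suc i) ≡
                          laplacianT· G (Vector.tail z) i + ⟦ v =ᶠ i ⟧ * (⟦ b ⟧ * z (suc v) - z zero)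
  laplacianT-extend-suc z i = begin
    laplacian H zero (suc i) * z zero + sumFin (λ j → laplacian H (suc j) (suc i) * z (suc j))
      ≡⟨ cong₂ _+_ (cong (_* z zero) (laplacian-extend-zero-suc i)) (sumFin-cong column-entry) ⟩
    - δ * z zero + sumFin (λ j → old j + new j)
      ≡⟨ cong (_+_ (- δ * z zero)) (sumFin-+ old new) ⟩
    - δ * z zero + (L + sumFin new)
      ≡⟨ cong (λ s → - δ * z zero + (L + s)) (trans (sumFin-δ i _) new-arrow-term) ⟩
    - δ * z zero + (L + δ * (⟦ b ⟧ * z (suc v)))
      ≡⟨ -dx+[l+dy]≡l+d[y-x] δ (z zero) L (⟦ b ⟧ * z (suc v)) ⟩
    L + δ * (⟦ b ⟧ * z (suc v) - z zero) ∎
    where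
    δ = ⟦ v =ᶠ i ⟧
    L = laplacianT· G (Vector.tail z) i
    old new : Fin n → ℤ
    old j = laplacian G j i * z (suc j)
    new j = ⟦ j =ᶠ i ⟧ * (⟦ b ⟧ * δ * z (suc j))
    [l+dc]w≡lw+d[cw] : ∀ l d c w → (l + d * c) * w ≡ l * w + d * (c * w)
    [l+dc]w≡lw+d[cw] = solve-∀
    xy*w≡y*[xw] : ∀ x y w → x * y * w ≡ y * (x * w)
    xy*w≡y*[xw] = solve-∀
    -dx+[l+dy]≡l+d[y-x] : ∀ d x l y → - d * x + (l + d * y) ≡ l + d * (y - x)
    -dx+[l+dy]≡l+d[y-x] = solve-∀
    column-entry : ∀ j → laplacian H (suc j) (suc i) * z (suc j) ≡ old j + new j
    column-entry j = trans (cong (_* z (suc j)) (laplacian-extend-suc-suc j i))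
      ([l+dc]w≡lw+d[cw] (laplacian G j i) ⟦ j =ᶠ i ⟧ (⟦ b ⟧ * δ) (z (suc j)))
    new-arrow-term : ⟦ b ⟧ * δ * z (suc i) ≡ δ * (⟦ b ⟧ * z (suc v))
    new-arrow-term = trans (xy*w≡y*[xw] ⟦ b ⟧ δ (z (suc i)))
      (⟦=ᶠ⟧-subst (λ k → ⟦ b ⟧ * z (suc k)) v i)

  laplacianT-extend-balanced : ∀ z → z zero ≡ ⟦ b ⟧ * z (suc v) →
                               laplacianT· H z ≗ embed (laplacianT· G (Vector.tail z))
  laplacianT-extend-balanced z z₀≡bzᵥ zero = begin
    laplacianT· H z zero ≡⟨ laplacianT-extend-zero z ⟩
    z zero - bzᵥ         ≡⟨ cong (_- bzᵥ) z₀≡bzᵥ ⟩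
    bzᵥ - bzᵥ            ≡⟨ ℤ.+-inverseʳ bzᵥ ⟩
    + 0                  ∎
    where
    bzᵥ = ⟦ b ⟧ * z (suc v)
  laplacianT-extend-balanced z z₀≡bzᵥ (suc i) = begin
    laplacianT· H z (suc i)   ≡⟨ laplacianT-extend-suc z i ⟩
    L + δ * (bzᵥ - z zero)    ≡⟨ cong (λ t → L + δ * (bzᵥ - t)) z₀≡bzᵥ ⟩
    L + δ * (bzᵥ - bzᵥ)       ≡⟨ cong (λ t → L + δ * t) (ℤ.+-inverseʳ bzᵥ) ⟩
    L + δ * + 0               ≡⟨ cong (_+_ L) (ℤ.*-zeroʳ δ) ⟩
    L + + 0                   ≡⟨ ℤ.+-identityʳ L ⟩
    L                         ∎
    where
    bzᵥ = ⟦ b ⟧ * z (suc v)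
    δ   = ⟦ v =ᶠ i ⟧
    L   = laplacianT· G (Vector.tail z) i

  embed-cong : ∀ {x y} → x ≈Pic[ G ] y → embed x ≈Pic[ H ] embed y
  embed-cong (z , x-y≡Lz) = u , λ where
      zero    → sym (laplacianT-extend-balanced u refl zero)
      (suc i) → trans (x-y≡Lz i) (sym (laplacianT-extend-balanced u refl (suc i)))
    where
    u = ⟦ b ⟧ * z v Vector.∷ z

  embed-injective : ∀ {x y} → embed x ≈Pic[ H ] embed y → x ≈Pic[ G ] y
  embed-injective (u , x-y≡Lu) = Vector.tail u , λ i →
    trans (x-y≡Lu (suc i)) (laplacianT-extend-balanced u u-balanced (suc i))
    where
    u-balanced : u zero ≡ ⟦ b ⟧ * u (suc v)
    u-balanced = ℤ.i-j≡0⇒i≡j _ _ (trans (sym (laplacianT-extend-zero u)) (sym (x-y≡Lu zero)))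

  collapse : (Fin (ℕ.suc n) → ℤ) → Fin n → ℤ
  collapse y i = y (suc i) + ⟦ v =ᶠ i ⟧ * y zero

  embed-collapse : ∀ y {z} → z ≈Pic[ G ] collapse y → embed z ≈Pic[ H ] y
  embed-collapse y {z} (u , z-x≡Lu) = w , λ where
      zero    → trans (0-y≡[c-y]-c (y zero) c) (sym (laplacianT-extend-zero w))
      (suc i) → begin
        z i - y (suc i)
          ≡⟨ rearrange (z i) (y (suc i)) ⟦ v =ᶠ i ⟧ (y zero) c ⟩
        z i - collapse y i + ⟦ v =ᶠ i ⟧ * (c - (c - y zero))
          ≡⟨ cong (_+ ⟦ v =ᶠ i ⟧ * (c - (c - y zero))) (z-x≡Lu i) ⟩
        laplacianT· G u i + ⟦ v =ᶠ i ⟧ * (c - (c - y zero))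
          ≡⟨ laplacianT-extend-suc w i ⟨
        laplacianT· H w (suc i) ∎
    where
    c = ⟦ b ⟧ * u v
    w = c - y zero Vector.∷ u
    0-y≡[c-y]-c : ∀ y c → + 0 - y ≡ (c - y) - c
    0-y≡[c-y]-c = solve-∀
    rearrange : ∀ z y d y₀ c → z - y ≡ z - (y + d * y₀) + d * (c - (c - y₀))
    rearrange = solve-∀

  embed-surjective : ∀ y → ∃ λ x → ∀ {z} → z ≈Pic[ G ] x → embed z ≈Pic[ H ] y
  embed-surjective y = collapse y , embed-collapse y

lemma3p1 : ∀ {n : ℕ} (G : DiGraph n) (v : Fin n) (b : Bool) →
    ∃ λ f → GroupMorphisms.IsGroupIsomorphism (Pic G) (Pic (extend G v b)) f
lemma3p1 G v b = embed , record
  { isGroupMonomorphism = record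
    { isGroupHomomorphism = record
      { isMonoidHomomorphism = record
        { isMagmaHomomorphism = record
          { isRelHomomorphism = record { cong = embed-cong G v b }
          ; homo = λ x y → ≈Pic-reflexive H (embed-+ x y)
          }
        ; ε-homo = ≈Pic-reflexive H embed-0
        }
      ; ⁻¹-homo = λ x → ≈Pic-reflexive H (embed-neg x)
      }
    ; injective = embed-injective G v b
    }
  ; surjective = embed-surjective G v b
  }
  where
  H = extend G v b
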